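{- Let $A$ be a finite abelian group and let $[a,b]$ be a vertex of the K\"ohler graph of $A$. Then the set of neighbors of $[a,b]$ is $$N([a,b])=\{[a,a+b],\ [b,a-b],\ [a,b-a]\}\cap\mathcal T.$$
   Context: For a finite abelian group $A$ (additive), $\hat A$ is the permutation group on $A$ generated by translations $x\mapsto x+a$ and $x\mapsto -x$; $[a_1,\dots,a_t]$ denotes the $\hat A$-orbit $\{\{0,a_1,\dots,a_t\}+c\}_{c\in A}\cup\{ -\{0,a_1,\dots,a_t\}+c\}_{c\in A}$. Let $\mathcal T=\{[a,b]: a,b\in A,\ a\ne\pm b,\ 2a\notin\{0,b,2b\},\ 2b\notin\{0,a,2a\}\}$ and $\mathcal E=\{[a,b,a+b]: a,b\in A,\ 0\notin\{2a,2b\},\ \{\pm a,\pm 2a\}\cap\{\pm b,\pm 2b\}=\emptyset\}$. The K\"ohler graph of $A$ has vertex set $\mathcal T$ and edge set $\mathcal E$, the orbit of a triple $T$ being incident with the orbit of a quadruple $B$ if $B\supseteq T'$ for some $T'$ in the orbit of $T$. The neighbors of a vertex are the other vertices incident with an edge incident with it. -}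

module Defs where

open import Level using (_⊔_)
open import Algebra.Bundles using (AbelianGroup)
open import Data.List using (List; []; _∷_; map)
open import Data.List.Relation.Unary.Any using (Any)
open import Data.List.Relation.Unary.All using (All)
open import Data.Product using (Σ; ∃; _×_; _,_)
open import Data.Sum using (_⊎_)
open import Relation.Nullary using (¬_)
open import Function.Bundles using (_⇔_)

module _ {c ℓ} (G : AbelianGroup c ℓ) where
  open AbelianGroup G renaming (Carrier to A; _∙_ to _+_; ε to 0#; _⁻¹ to -_)

  -- membership in a finite subset (given as a list), up to the group's equality
  _∈ₛ_ : A → List A → Set (c ⊔ ℓ)
  x ∈ₛ X = Any (x ≈_) X

  Finite : Set (c ⊔ ℓ)
  Finite = Σ (List A) λ enum → ∀ x → x ∈ₛ enum

  _⊆ₛ_ : List A → List A → Set (c ⊔ ℓ)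
  X ⊆ₛ Y = ∀ x → x ∈ₛ X → x ∈ₛ Y

  _≐_ : List A → List A → Set (c ⊔ ℓ)
  X ≐ Y = X ⊆ₛ Y × Y ⊆ₛ X

  double : A → A
  double x = x + x

  -- the Â-orbit of a finite subset S of A, as a predicate on finite subsets:
  -- X is in the orbit iff X = S + t or X = -S + t for some t ∈ A
  Orbit : List A → List A → Set (c ⊔ ℓ)
  Orbit S X = ∃ λ t → (X ≐ map (λ s → s + t) S) ⊎ (X ≐ map (λ s → (- s) + t) S)

  OrbEq : List A → List A → Set (c ⊔ ℓ)
  OrbEq S S' = ∀ X → Orbit S X ⇔ Orbit S' X

  -- the sets {0,a,b} and {0,a,b,c}; [a,b] is the orbit of the former
  tri : A → A → List A
  tri a b = 0# ∷ a ∷ b ∷ []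

  quad : A → A → A → List A
  quad a b d = 0# ∷ a ∷ b ∷ d ∷ []

  _∉₃_ : A → List A → Set (c ⊔ ℓ)
  x ∉₃ X = ¬ (x ∈ₛ X)

  TriCond : A → A → Set (c ⊔ ℓ)
  TriCond a b = ¬ (a ≈ b) × ¬ (a ≈ - b)
              × (double a ∉₃ (0# ∷ b ∷ double b ∷ []))
              × (double b ∉₃ (0# ∷ a ∷ double a ∷ []))

  QuadCond : A → A → Set (c ⊔ ℓ)
  QuadCond a b = ¬ (double a ≈ 0#) × ¬ (double b ≈ 0#)
               × All (λ u → u ∉₃ (b ∷ - b ∷ double b ∷ - double b ∷ []))
                     (a ∷ - a ∷ double a ∷ - double a ∷ [])

  Vertex : List A → Set (c ⊔ ℓ)
  Vertex S = ∃ λ a → ∃ λ b → TriCond a b × OrbEq S (tri a b)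

  Edge : List A → Set (c ⊔ ℓ)
  Edge S = ∃ λ a → ∃ λ b → QuadCond a b × OrbEq S (quad a b (a + b))

  Incident : List A → List A → Set (c ⊔ ℓ)
  Incident T B = ∃ λ X → ∃ λ Y → Orbit T X × Orbit B Y × X ⊆ₛ Y

  Neighbor : List A → List A → Set (c ⊔ ℓ)
  Neighbor V W = Vertex W × ¬ OrbEq W V
               × ∃ λ E → Edge E × Incident V E × Incident W E

-- An edge is the orbit of a parallelogram {0, p, q, p + q}, and the four triangles inside it fall
-- into exactly two orbits, [p, q] and [p, p + q]; these differ, since the side q - p of the first
-- is not (up to sign) a side of the second. Hence two neighbours are the two kinds of triangle of
-- one parallelogram. Conversely, a copy of {0, a, b} extends to a parallelogram only by adding the
-- point opposite to one of 0, a, b, and the triangle of the other kind then has orbit [a, a + b],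
-- [b, a - b] or [a, b - a] respectively; non-degeneracy of both triangles makes the parallelogram
-- an edge. The bookkeeping rests on properties of ordered triangles that are invariant under
-- permuting the vertices and under Â, and therefore only depend on the orbit.

module Submission where

open import Defs
open import Algebra.Bundles using (AbelianGroup)
open import Data.List using (List; []; _∷_; map)
open import Data.Product using (_×_; _,_; Σ; proj₁; proj₂)
open import Data.Sum using (_⊎_; inj₁; inj₂)
open import Function.Bundles using (_⇔_; mk⇔; Equivalence)

open import Data.Empty using (⊥; ⊥-elim)
open import Data.Fin using (Fin; zero; suc)
open import Data.List.Relation.Unary.All using ([]; _∷_)
open import Data.List.Relation.Unary.Any using (here; there)
import Data.List.Properties as List
open import Data.Nat using (ℕ; zero; suc) renaming (_+_ to _+ℕ_)
import Data.Sum as Sum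
open import Data.Vec using (Vec; []; _∷_; lookup; replicate; zipWith)
import Data.Vec as Vec
open import Function.Base using (_∘_; id)
open import Level using (_⊔_)
import Relation.Binary.PropositionalEquality as ≡
import Relation.Binary.Reflection as Reflection
open import Relation.Nullary using (¬_)

module AbelianGroupSolver {c ℓ} (G : AbelianGroup c ℓ) where
  open AbelianGroup G
  open import Algebra.Properties.AbelianGroup G using (⁻¹-∙-comm; ⁻¹-involutive; ε⁻¹≈ε)
  open import Algebra.Properties.CommutativeSemigroup commutativeSemigroup using (interchange)
  open import Algebra.Properties.Monoid.Mult monoid using (×-homo-+) renaming (_×_ to _×ᵐ_)
  open import Relation.Binary.Reasoning.Setoid setoid

  infixl 6 _⊕_ _⊖_
  infix 7 ⊝_

  data Expr (n : ℕ) : Set where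
    var : Fin n → Expr n
    𝟎   : Expr n
    _⊕_ : Expr n → Expr n → Expr n
    ⊝_  : Expr n → Expr n

  _⊖_ : ∀ {n} → Expr n → Expr n → Expr n
  e ⊖ f = e ⊕ ⊝ f

  ⟦_⟧ : ∀ {n} → Expr n → Vec Carrier n → Carrier
  ⟦ var i ⟧ ρ = lookup ρ i
  ⟦ 𝟎 ⟧     ρ = ε
  ⟦ e ⊕ f ⟧ ρ = ⟦ e ⟧ ρ ∙ ⟦ f ⟧ ρ
  ⟦ ⊝ e ⟧   ρ = ⟦ e ⟧ ρ ⁻¹

  -- A coefficient (p , q) stands for the integer p - q. It is kept reduced (min p q = 0), so
  -- equal expressions have syntactically equal normal forms and  solve n f refl  succeeds.
  Coefficient : Set
  Coefficient = ℕ × ℕ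

  reduce : ℕ → ℕ → Coefficient
  reduce (suc p) (suc q) = reduce p q
  reduce p q = p , q

  _·_ : Coefficient → Carrier → Carrier
  (p , q) · x = p ×ᵐ x ∙ (q ×ᵐ x) ⁻¹

  Normal : ℕ → Set
  Normal = Vec Coefficient

  ⟦_⇓⟧ₙ : ∀ {n} → Normal n → Vec Carrier n → Carrier
  ⟦ [] ⇓⟧ₙ     []      = ε
  ⟦ k ∷ v ⇓⟧ₙ (x ∷ ρ) = k · x ∙ ⟦ v ⇓⟧ₙ ρ

  unit : ∀ {n} → Fin n → Normal n
  unit zero    = (1 , 0) ∷ replicate _ (0 , 0)
  unit (suc i) = (0 , 0) ∷ unit i

  add : Coefficient → Coefficient → Coefficient
  add (p , q) (p′ , q′) = reduce (p +ℕ p′) (q +ℕ q′)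

  negate : Coefficient → Coefficient
  negate (p , q) = q , p

  normalise : ∀ {n} → Expr n → Normal n
  normalise (var i) = unit i
  normalise 𝟎       = replicate _ (0 , 0)
  normalise (e ⊕ f) = zipWith add (normalise e) (normalise f)
  normalise (⊝ e)   = Vec.map negate (normalise e)

  ⟦_⇓⟧ : ∀ {n} → Expr n → Vec Carrier n → Carrier
  ⟦ e ⇓⟧ = ⟦ normalise e ⇓⟧ₙ

  0·x≈ε : ∀ x → (0 , 0) · x ≈ ε
  0·x≈ε x = trans (identityˡ _) ε⁻¹≈ε

  reduce-correct : ∀ p q x → reduce p q · x ≈ (p , q) · x
  reduce-correct (suc p) (suc q) x = begin
    reduce p q · x                          ≈⟨ reduce-correct p q x ⟩
    p ×ᵐ x ∙ (q ×ᵐ x) ⁻¹                    ≈⟨ identityˡ _ ⟨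
    ε ∙ (p ×ᵐ x ∙ (q ×ᵐ x) ⁻¹)              ≈⟨ ∙-congʳ (inverseʳ x) ⟨
    x ∙ x ⁻¹ ∙ (p ×ᵐ x ∙ (q ×ᵐ x) ⁻¹)       ≈⟨ interchange _ _ _ _ ⟩
    x ∙ p ×ᵐ x ∙ (x ⁻¹ ∙ (q ×ᵐ x) ⁻¹)       ≈⟨ ∙-congˡ (⁻¹-∙-comm _ _) ⟩
    suc p ×ᵐ x ∙ (suc q ×ᵐ x) ⁻¹            ∎
  reduce-correct zero    q    x = refl
  reduce-correct (suc p) zero x = refl

  add-correct : ∀ k k′ x → add k k′ · x ≈ k · x ∙ k′ · x
  add-correct (p , q) (p′ , q′) x = begin
    reduce (p +ℕ p′) (q +ℕ q′) · x
      ≈⟨ reduce-correct (p +ℕ p′) (q +ℕ q′) x ⟩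
    (p +ℕ p′) ×ᵐ x ∙ ((q +ℕ q′) ×ᵐ x) ⁻¹
      ≈⟨ ∙-cong (×-homo-+ x p p′) (⁻¹-cong (×-homo-+ x q q′)) ⟩
    (p ×ᵐ x ∙ p′ ×ᵐ x) ∙ (q ×ᵐ x ∙ q′ ×ᵐ x) ⁻¹
      ≈⟨ ∙-congˡ (⁻¹-∙-comm _ _) ⟨
    (p ×ᵐ x ∙ p′ ×ᵐ x) ∙ ((q ×ᵐ x) ⁻¹ ∙ (q′ ×ᵐ x) ⁻¹)
      ≈⟨ interchange _ _ _ _ ⟩
    (p , q) · x ∙ (p′ , q′) · x
      ∎

  negate-correct : ∀ k x → negate k · x ≈ (k · x) ⁻¹
  negate-correct (p , q) x = begin
    q ×ᵐ x ∙ (p ×ᵐ x) ⁻¹            ≈⟨ comm _ _ ⟩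
    (p ×ᵐ x) ⁻¹ ∙ q ×ᵐ x            ≈⟨ ∙-congˡ (⁻¹-involutive _) ⟨
    (p ×ᵐ x) ⁻¹ ∙ ((q ×ᵐ x) ⁻¹) ⁻¹  ≈⟨ ⁻¹-∙-comm _ _ ⟩
    (p ×ᵐ x ∙ (q ×ᵐ x) ⁻¹) ⁻¹       ∎

  zero-correct : ∀ {n} (ρ : Vec Carrier n) → ⟦ replicate n (0 , 0) ⇓⟧ₙ ρ ≈ ε
  zero-correct []      = refl
  zero-correct (x ∷ ρ) = trans (∙-cong (0·x≈ε x) (zero-correct ρ)) (identityʳ ε)

  unit-correct : ∀ {n} (i : Fin n) ρ → ⟦ unit i ⇓⟧ₙ ρ ≈ lookup ρ i
  unit-correct zero    (x ∷ ρ) =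
    trans (∙-cong (trans (∙-cong (identityʳ x) ε⁻¹≈ε) (identityʳ x)) (zero-correct ρ)) (identityʳ x)
  unit-correct (suc i) (x ∷ ρ) = trans (∙-cong (0·x≈ε x) (unit-correct i ρ)) (identityˡ _)

  add-correctₙ : ∀ {n} (v w : Normal n) ρ → ⟦ zipWith add v w ⇓⟧ₙ ρ ≈ ⟦ v ⇓⟧ₙ ρ ∙ ⟦ w ⇓⟧ₙ ρ
  add-correctₙ []      []       []      = sym (identityˡ ε)
  add-correctₙ (k ∷ v) (k′ ∷ w) (x ∷ ρ) =
    trans (∙-cong (add-correct k k′ x) (add-correctₙ v w ρ)) (interchange _ _ _ _)

  negate-correctₙ : ∀ {n} (v : Normal n) ρ → ⟦ Vec.map negate v ⇓⟧ₙ ρ ≈ ⟦ v ⇓⟧ₙ ρ ⁻¹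
  negate-correctₙ []      []      = sym ε⁻¹≈ε
  negate-correctₙ (k ∷ v) (x ∷ ρ) =
    trans (∙-cong (negate-correct k x) (negate-correctₙ v ρ)) (⁻¹-∙-comm _ _)

  correct : ∀ {n} (e : Expr n) ρ → ⟦ e ⇓⟧ ρ ≈ ⟦ e ⟧ ρ
  correct (var i) ρ = unit-correct i ρ
  correct 𝟎       ρ = zero-correct ρ
  correct (e ⊕ f) ρ =
    trans (add-correctₙ (normalise e) (normalise f) ρ) (∙-cong (correct e ρ) (correct f ρ))
  correct (⊝ e)   ρ = trans (negate-correctₙ (normalise e) ρ) (⁻¹-cong (correct e ρ))

  open Reflection setoid var ⟦_⟧ ⟦_⇓⟧ correct public using (solve; _⊜_)

module _ {c ℓ} (G : AbelianGroup c ℓ) where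
  open AbelianGroup G hiding (inverse) renaming (Carrier to A; _∙_ to _+_; ε to 0#; _⁻¹ to -_)
  open import Algebra.Properties.AbelianGroup G
    using (⁻¹-involutive; ⁻¹-anti-homo‿-; inverseˡ-unique; x∙y⁻¹≈ε⇒x≈y; x≈y⇒x∙y⁻¹≈ε)
  open AbelianGroupSolver G using (solve; _⊜_; 𝟎; _⊕_; _⊖_; ⊝_)
  open import Data.List.Membership.Setoid setoid using (_∈_)
  open import Data.List.Membership.Setoid.Properties using (∈-resp-≈)
  open import Data.List.Relation.Binary.Subset.Setoid.Properties using (map⁺)

  private variable
    a b p q x y z x′ y′ z′ d e e′ : A
    S S′ S″ T T′ B B′ V V′ W W′ X : List A
    f g : A → A

  ≈-by-difference : x - y ≈ x′ - y′ → x′ ≈ y′ → x ≈ y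
  ≈-by-difference eq x′≈y′ = x∙y⁻¹≈ε⇒x≈y _ _ (trans eq (x≈y⇒x∙y⁻¹≈ε x′≈y′))

  Midpoint : A → A → A → Set ℓ
  Midpoint x y z = x + x ≈ y + z

  Midpoint-cong : x ≈ x′ → y ≈ y′ → z ≈ z′ → Midpoint x′ y′ z′ → Midpoint x y z
  Midpoint-cong x≈ y≈ z≈ m = trans (∙-cong x≈ x≈) (trans m (sym (∙-cong y≈ z≈)))

  -- TriCond a b says that {0, a, b} satisfies this condition, which is symmetric in the three
  -- points: no difference of two of them has order at most 2, and none is the midpoint of the
  -- other two.
  record NonDegenerate (x y z : A) : Set ℓ where
    constructor nonDegenerate
    field
      2x≉2y  : ¬ Midpoint x y y
      2y≉2z  : ¬ Midpoint y z z
      2z≉2x  : ¬ Midpoint z x x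
      2x≉y+z : ¬ Midpoint x y z
      2y≉z+x : ¬ Midpoint y z x
      2z≉x+y : ¬ Midpoint z x y

  TriCond⇒NonDegenerate : TriCond G a b → NonDegenerate 0# a b
  TriCond⇒NonDegenerate {a} {b} (_ , a≉-b , 2a∉ , 2b∉) = nonDegenerate
    (λ h → 2a∉ (here (trans (sym h) (identityʳ 0#))))
    (λ h → 2a∉ (there (there (here h))))
    (λ h → 2b∉ (here (trans h (identityʳ 0#))))
    (λ h → a≉-b (inverseˡ-unique a b (trans (sym h) (identityʳ 0#))))
    (λ h → 2a∉ (there (here (trans h (identityʳ b)))))
    (λ h → 2b∉ (there (here (trans h (identityˡ a)))))

  NonDegenerate⇒TriCond : NonDegenerate 0# a b → TriCond G a b
  NonDegenerate⇒TriCond {a} {b} nd =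
      (λ a≈b → 2y≉2z (∙-cong a≈b a≈b))
    , (λ a≈-b → 2x≉y+z (trans (identityʳ 0#) (sym (trans (∙-congʳ a≈-b) (inverseˡ b)))))
    , (λ { (here h)                 → 2x≉2y (trans (identityʳ 0#) (sym h))
         ; (there (here h))         → 2y≉z+x (trans h (sym (identityʳ b)))
         ; (there (there (here h))) → 2y≉2z h })
    , (λ { (here h)                 → 2z≉2x (trans h (sym (identityʳ 0#)))
         ; (there (here h))         → 2z≉x+y (trans h (sym (identityˡ a)))
         ; (there (there (here h))) → 2y≉2z (sym h) })
    where open NonDegenerate nd

  Distinct : A → A → A → Set ℓ
  Distinct x y z = x ≉ y × x ≉ z × y ≉ z

  NonDegenerate⇒Distinct : NonDegenerate x y z → Distinct x y z
  NonDegenerate⇒Distinct nd =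
    (λ e → 2x≉2y (∙-cong e e)) , (λ e → 2z≉2x (sym (∙-cong e e))) , (λ e → 2y≉2z (∙-cong e e))
    where open NonDegenerate nd

  TriCond⇒Distinct : TriCond G a b → Distinct 0# a b
  TriCond⇒Distinct = NonDegenerate⇒Distinct ∘ TriCond⇒NonDegenerate

  -- Every element of Â has one of these two forms; they are the two cases of Defs.Orbit.
  data Affine : Set c where
    translate reflect : A → Affine

  apply : Affine → A → A
  apply (translate t) x = x + t
  apply (reflect t)   x = - x + t

  apply-cong : ∀ σ → x ≈ y → apply σ x ≈ apply σ y
  apply-cong (translate t) x≈y = ∙-congʳ x≈y
  apply-cong (reflect t)   x≈y = ∙-congʳ (⁻¹-cong x≈y)

  infixr 9 _∘ᵃ_
  _∘ᵃ_ : Affine → Affine → Affine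
  translate t ∘ᵃ translate u = translate (u + t)
  translate t ∘ᵃ reflect u   = reflect (u + t)
  reflect t   ∘ᵃ translate u = reflect (- u + t)
  reflect t   ∘ᵃ reflect u   = translate (- u + t)

  apply-∘ : ∀ σ τ x → apply (σ ∘ᵃ τ) x ≈ apply σ (apply τ x)
  apply-∘ (translate t) (translate u) x =
    solve 3 (λ x u t → x ⊕ (u ⊕ t) ⊜ x ⊕ u ⊕ t) refl x u t
  apply-∘ (translate t) (reflect u)   x =
    solve 3 (λ x u t → ⊝ x ⊕ (u ⊕ t) ⊜ ⊝ x ⊕ u ⊕ t) refl x u t
  apply-∘ (reflect t)   (translate u) x =
    solve 3 (λ x u t → ⊝ x ⊕ (⊝ u ⊕ t) ⊜ ⊝ (x ⊕ u) ⊕ t) refl x u t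
  apply-∘ (reflect t)   (reflect u)   x =
    solve 3 (λ x u t → x ⊕ (⊝ u ⊕ t) ⊜ ⊝ (⊝ x ⊕ u) ⊕ t) refl x u t

  inverse : Affine → Affine
  inverse (translate t) = translate (- t)
  inverse (reflect t)   = reflect t

  apply-inverse : ∀ σ x → apply (inverse σ) (apply σ x) ≈ x
  apply-inverse (translate t) x = solve 2 (λ x t → x ⊕ t ⊖ t ⊜ x) refl x t
  apply-inverse (reflect t)   x = solve 2 (λ x t → ⊝ (⊝ x ⊕ t) ⊕ t ⊜ x) refl x t

  apply-injective : ∀ σ → apply σ x ≈ apply σ y → x ≈ y
  apply-injective σ eq =
    trans (sym (apply-inverse σ _)) (trans (apply-cong (inverse σ) eq) (apply-inverse σ _))

  apply-distinct : ∀ σ → Distinct x y z → Distinct (apply σ x) (apply σ y) (apply σ z)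
  apply-distinct σ (x≉y , x≉z , y≉z) =
    (x≉y ∘ apply-injective σ) , (x≉z ∘ apply-injective σ) , (y≉z ∘ apply-injective σ)

  ≐-refl : _≐_ G S S
  ≐-refl = (λ _ m → m) , (λ _ m → m)

  ≐-sym : _≐_ G S S′ → _≐_ G S′ S
  ≐-sym (S⊆S′ , S′⊆S) = S′⊆S , S⊆S′

  ≐-trans : _≐_ G S S′ → _≐_ G S′ S″ → _≐_ G S S″
  ≐-trans (l , r) (l′ , r′) = (λ x m → l′ x (l x m)) , (λ x m → r x (r′ x m))

  ≐-reflexive : S ≡.≡ S′ → _≐_ G S S′
  ≐-reflexive ≡.refl = ≐-refl

  map-apply-≐ : ∀ σ → _≐_ G S S′ → _≐_ G (map (apply σ) S) (map (apply σ) S′)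
  map-apply-≐ σ (S⊆S′ , S′⊆S) =
    (λ _ → map⁺ setoid setoid (apply-cong σ) (λ {x} → S⊆S′ x)) ,
    (λ _ → map⁺ setoid setoid (apply-cong σ) (λ {x} → S′⊆S x))

  map-≈-⊆ : (∀ x → f x ≈ g x) → ∀ S → _⊆ₛ_ G (map f S) (map g S)
  map-≈-⊆ f≈g (s ∷ S) _ (here e)  = here (trans e (f≈g s))
  map-≈-⊆ f≈g (s ∷ S) y (there m) = there (map-≈-⊆ f≈g S y m)

  map-≈ : (∀ x → f x ≈ g x) → ∀ S → _≐_ G (map f S) (map g S)
  map-≈ f≈g S = map-≈-⊆ f≈g S , map-≈-⊆ (λ x → sym (f≈g x)) S

  map-map-≈ : ∀ {h} → (∀ x → f (g x) ≈ h x) → ∀ S → _≐_ G (map f (map g S)) (map h S)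
  map-map-≈ fg≈h S = ≐-trans (≐-reflexive (≡.sym (List.map-∘ S))) (map-≈ fg≈h S)

  orbit⇒image : Orbit G S X → Σ Affine λ σ → _≐_ G X (map (apply σ) S)
  orbit⇒image (t , inj₁ X≐) = translate t , X≐
  orbit⇒image (t , inj₂ X≐) = reflect t , X≐

  image⇒orbit : ∀ σ → _≐_ G X (map (apply σ) S) → Orbit G S X
  image⇒orbit (translate t) X≐ = t , inj₁ X≐
  image⇒orbit (reflect t)   X≐ = t , inj₂ X≐

  orbit-refl : Orbit G S S
  orbit-refl {S} = image⇒orbit (translate 0#)
    (≐-sym (≐-trans (map-≈ identityʳ S) (≐-reflexive (List.map-id S))))

  OrbEq-refl : OrbEq G S S
  OrbEq-refl X = mk⇔ id id

  OrbEq-sym : OrbEq G S S′ → OrbEq G S′ S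
  OrbEq-sym S~S′ X = mk⇔ (Equivalence.from (S~S′ X)) (Equivalence.to (S~S′ X))

  OrbEq-trans : OrbEq G S S′ → OrbEq G S′ S″ → OrbEq G S S″
  OrbEq-trans S~S′ S′~S″ X = mk⇔
    (Equivalence.to (S′~S″ X) ∘ Equivalence.to (S~S′ X))
    (Equivalence.from (S~S′ X) ∘ Equivalence.from (S′~S″ X))

  ≐⇒OrbEq : _≐_ G S S′ → OrbEq G S S′
  ≐⇒OrbEq S≐S′ X = mk⇔ (move S≐S′) (move (≐-sym S≐S′))
    where
    move : _≐_ G S S′ → Orbit G S X → Orbit G S′ X
    move S≐S′ o = let σ , X≐ = orbit⇒image o in image⇒orbit σ (≐-trans X≐ (map-apply-≐ σ S≐S′))

  OrbEq-respʳ-≐ : _≐_ G S S′ → OrbEq G W S → OrbEq G W S′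
  OrbEq-respʳ-≐ S≐S′ W~S = OrbEq-trans W~S (≐⇒OrbEq S≐S′)

  OrbEq-image : ∀ σ S → OrbEq G S (map (apply σ) S)
  OrbEq-image σ S X = mk⇔ to from
    where
    to : Orbit G S X → Orbit G (map (apply σ) S) X
    to o = let τ , X≐ = orbit⇒image o in
      image⇒orbit (τ ∘ᵃ inverse σ) (≐-trans X≐ (≐-sym (map-map-≈ (λ x →
        trans (apply-∘ τ (inverse σ) (apply σ x)) (apply-cong τ (apply-inverse σ x))) S)))
    from : Orbit G (map (apply σ) S) X → Orbit G S X
    from o = let τ , X≐ = orbit⇒image o in
      image⇒orbit (τ ∘ᵃ σ) (≐-trans X≐ (map-map-≈ (λ x → sym (apply-∘ τ σ x)) S))

  image-OrbEq : ∀ σ τ → _≐_ G (map (apply σ) S) (map (apply τ) S′) → OrbEq G S S′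
  image-OrbEq σ τ σS≐τS′ =
    OrbEq-trans (OrbEq-image σ _) (OrbEq-trans (≐⇒OrbEq σS≐τS′) (OrbEq-sym (OrbEq-image τ _)))

  pattern at₀ e = here e
  pattern at₁ e = there (here e)
  pattern at₂ e = there (there (here e))
  pattern at₃ e = there (there (there (here e)))

  -- πijk : x₀, x₁, x₂ are y_i, y_j, y_k respectively (up to ≈).
  data Permutation₃ (x₀ x₁ x₂ y₀ y₁ y₂ : A) : Set ℓ where
    π012 : x₀ ≈ y₀ → x₁ ≈ y₁ → x₂ ≈ y₂ → Permutation₃ x₀ x₁ x₂ y₀ y₁ y₂
    π021 : x₀ ≈ y₀ → x₁ ≈ y₂ → x₂ ≈ y₁ → Permutation₃ x₀ x₁ x₂ y₀ y₁ y₂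
    π102 : x₀ ≈ y₁ → x₁ ≈ y₀ → x₂ ≈ y₂ → Permutation₃ x₀ x₁ x₂ y₀ y₁ y₂
    π120 : x₀ ≈ y₁ → x₁ ≈ y₂ → x₂ ≈ y₀ → Permutation₃ x₀ x₁ x₂ y₀ y₁ y₂
    π201 : x₀ ≈ y₂ → x₁ ≈ y₀ → x₂ ≈ y₁ → Permutation₃ x₀ x₁ x₂ y₀ y₁ y₂
    π210 : x₀ ≈ y₂ → x₁ ≈ y₁ → x₂ ≈ y₀ → Permutation₃ x₀ x₁ x₂ y₀ y₁ y₂

  private variable
    x₀ x₁ x₂ y₀ y₁ y₂ y₃ : A

  Permutation₃-sym : Permutation₃ x₀ x₁ x₂ y₀ y₁ y₂ → Permutation₃ y₀ y₁ y₂ x₀ x₁ x₂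
  Permutation₃-sym (π012 e₀ e₁ e₂) = π012 (sym e₀) (sym e₁) (sym e₂)
  Permutation₃-sym (π021 e₀ e₁ e₂) = π021 (sym e₀) (sym e₂) (sym e₁)
  Permutation₃-sym (π102 e₀ e₁ e₂) = π102 (sym e₁) (sym e₀) (sym e₂)
  Permutation₃-sym (π120 e₀ e₁ e₂) = π201 (sym e₂) (sym e₀) (sym e₁)
  Permutation₃-sym (π201 e₀ e₁ e₂) = π120 (sym e₁) (sym e₂) (sym e₀)
  Permutation₃-sym (π210 e₀ e₁ e₂) = π210 (sym e₂) (sym e₁) (sym e₀)

  ∈⇒⊆ : x₀ ∈ S → x₁ ∈ S → x₂ ∈ S → _⊆ₛ_ G (x₀ ∷ x₁ ∷ x₂ ∷ []) S
  ∈⇒⊆ m₀ m₁ m₂ _ (at₀ e) = ∈-resp-≈ setoid (sym e) m₀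
  ∈⇒⊆ m₀ m₁ m₂ _ (at₁ e) = ∈-resp-≈ setoid (sym e) m₁
  ∈⇒⊆ m₀ m₁ m₂ _ (at₂ e) = ∈-resp-≈ setoid (sym e) m₂

  Permutation₃⇒⊆ : Permutation₃ x₀ x₁ x₂ y₀ y₁ y₂ →
                   _⊆ₛ_ G (x₀ ∷ x₁ ∷ x₂ ∷ []) (y₀ ∷ y₁ ∷ y₂ ∷ [])
  Permutation₃⇒⊆ (π012 e₀ e₁ e₂) = ∈⇒⊆ (at₀ e₀) (at₁ e₁) (at₂ e₂)
  Permutation₃⇒⊆ (π021 e₀ e₁ e₂) = ∈⇒⊆ (at₀ e₀) (at₂ e₁) (at₁ e₂)
  Permutation₃⇒⊆ (π102 e₀ e₁ e₂) = ∈⇒⊆ (at₁ e₀) (at₀ e₁) (at₂ e₂)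
  Permutation₃⇒⊆ (π120 e₀ e₁ e₂) = ∈⇒⊆ (at₁ e₀) (at₂ e₁) (at₀ e₂)
  Permutation₃⇒⊆ (π201 e₀ e₁ e₂) = ∈⇒⊆ (at₂ e₀) (at₀ e₁) (at₁ e₂)
  Permutation₃⇒⊆ (π210 e₀ e₁ e₂) = ∈⇒⊆ (at₂ e₀) (at₁ e₁) (at₀ e₂)

  Permutation₃⇒≐ : Permutation₃ x₀ x₁ x₂ y₀ y₁ y₂ →
                   _≐_ G (x₀ ∷ x₁ ∷ x₂ ∷ []) (y₀ ∷ y₁ ∷ y₂ ∷ [])
  Permutation₃⇒≐ π = Permutation₃⇒⊆ π , Permutation₃⇒⊆ (Permutation₃-sym π)

  clash : x ≉ y → x ≈ z → y ≈ z → ⊥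
  clash x≉y x≈z y≈z = x≉y (trans x≈z (sym y≈z))

  three-of-three : Distinct x₀ x₁ x₂ → let Y = y₀ ∷ y₁ ∷ y₂ ∷ [] in
                   x₀ ∈ Y → x₁ ∈ Y → x₂ ∈ Y → Permutation₃ x₀ x₁ x₂ y₀ y₁ y₂
  three-of-three _ (at₀ e₀) (at₁ e₁) (at₂ e₂) = π012 e₀ e₁ e₂
  three-of-three _ (at₀ e₀) (at₂ e₁) (at₁ e₂) = π021 e₀ e₁ e₂
  three-of-three _ (at₁ e₀) (at₀ e₁) (at₂ e₂) = π102 e₀ e₁ e₂
  three-of-three _ (at₁ e₀) (at₂ e₁) (at₀ e₂) = π120 e₀ e₁ e₂
  three-of-three _ (at₂ e₀) (at₀ e₁) (at₁ e₂) = π201 e₀ e₁ e₂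
  three-of-three _ (at₂ e₀) (at₁ e₁) (at₀ e₂) = π210 e₀ e₁ e₂
  three-of-three (x₀≉x₁ , _) (at₀ e₀) (at₀ e₁) _ = ⊥-elim (clash x₀≉x₁ e₀ e₁)
  three-of-three (x₀≉x₁ , _) (at₁ e₀) (at₁ e₁) _ = ⊥-elim (clash x₀≉x₁ e₀ e₁)
  three-of-three (x₀≉x₁ , _) (at₂ e₀) (at₂ e₁) _ = ⊥-elim (clash x₀≉x₁ e₀ e₁)
  three-of-three (_ , x₀≉x₂ , _) (at₀ e₀) _ (at₀ e₂) = ⊥-elim (clash x₀≉x₂ e₀ e₂)
  three-of-three (_ , x₀≉x₂ , _) (at₁ e₀) _ (at₁ e₂) = ⊥-elim (clash x₀≉x₂ e₀ e₂)
  three-of-three (_ , x₀≉x₂ , _) (at₂ e₀) _ (at₂ e₂) = ⊥-elim (clash x₀≉x₂ e₀ e₂)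
  three-of-three (_ , _ , x₁≉x₂) _ (at₀ e₁) (at₀ e₂) = ⊥-elim (clash x₁≉x₂ e₁ e₂)
  three-of-three (_ , _ , x₁≉x₂) _ (at₁ e₁) (at₁ e₂) = ⊥-elim (clash x₁≉x₂ e₁ e₂)
  three-of-three (_ , _ , x₁≉x₂) _ (at₂ e₁) (at₂ e₂) = ⊥-elim (clash x₁≉x₂ e₁ e₂)

  ⊆⇒Permutation₃ : Distinct x₀ x₁ x₂ → _⊆ₛ_ G (x₀ ∷ x₁ ∷ x₂ ∷ []) (y₀ ∷ y₁ ∷ y₂ ∷ []) →
                   Permutation₃ x₀ x₁ x₂ y₀ y₁ y₂
  ⊆⇒Permutation₃ d X⊆Y = three-of-three d (X⊆Y _ (at₀ refl)) (X⊆Y _ (at₁ refl)) (X⊆Y _ (at₂ refl))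

  data ThreeOfFour (x₀ x₁ x₂ y₀ y₁ y₂ y₃ : A) : Set ℓ where
    omit₀ : Permutation₃ x₀ x₁ x₂ y₁ y₂ y₃ → ThreeOfFour x₀ x₁ x₂ y₀ y₁ y₂ y₃
    omit₁ : Permutation₃ x₀ x₁ x₂ y₀ y₂ y₃ → ThreeOfFour x₀ x₁ x₂ y₀ y₁ y₂ y₃
    omit₂ : Permutation₃ x₀ x₁ x₂ y₀ y₁ y₃ → ThreeOfFour x₀ x₁ x₂ y₀ y₁ y₂ y₃
    omit₃ : Permutation₃ x₀ x₁ x₂ y₀ y₁ y₂ → ThreeOfFour x₀ x₁ x₂ y₀ y₁ y₂ y₃

  three-of-four : Distinct x₀ x₁ x₂ → let Y = y₀ ∷ y₁ ∷ y₂ ∷ y₃ ∷ [] in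
                  x₀ ∈ Y → x₁ ∈ Y → x₂ ∈ Y → ThreeOfFour x₀ x₁ x₂ y₀ y₁ y₂ y₃
  three-of-four _ (at₀ e₀) (at₁ e₁) (at₂ e₂) = omit₃ (π012 e₀ e₁ e₂)
  three-of-four _ (at₀ e₀) (at₁ e₁) (at₃ e₂) = omit₂ (π012 e₀ e₁ e₂)
  three-of-four _ (at₀ e₀) (at₂ e₁) (at₁ e₂) = omit₃ (π021 e₀ e₁ e₂)
  three-of-four _ (at₀ e₀) (at₂ e₁) (at₃ e₂) = omit₁ (π012 e₀ e₁ e₂)
  three-of-four _ (at₀ e₀) (at₃ e₁) (at₁ e₂) = omit₂ (π021 e₀ e₁ e₂)
  three-of-four _ (at₀ e₀) (at₃ e₁) (at₂ e₂) = omit₁ (π021 e₀ e₁ e₂)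
  three-of-four _ (at₁ e₀) (at₀ e₁) (at₂ e₂) = omit₃ (π102 e₀ e₁ e₂)
  three-of-four _ (at₁ e₀) (at₀ e₁) (at₃ e₂) = omit₂ (π102 e₀ e₁ e₂)
  three-of-four _ (at₁ e₀) (at₂ e₁) (at₀ e₂) = omit₃ (π120 e₀ e₁ e₂)
  three-of-four _ (at₁ e₀) (at₂ e₁) (at₃ e₂) = omit₀ (π012 e₀ e₁ e₂)
  three-of-four _ (at₁ e₀) (at₃ e₁) (at₀ e₂) = omit₂ (π120 e₀ e₁ e₂)
  three-of-four _ (at₁ e₀) (at₃ e₁) (at₂ e₂) = omit₀ (π021 e₀ e₁ e₂)
  three-of-four _ (at₂ e₀) (at₀ e₁) (at₁ e₂) = omit₃ (π201 e₀ e₁ e₂)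
  three-of-four _ (at₂ e₀) (at₀ e₁) (at₃ e₂) = omit₁ (π102 e₀ e₁ e₂)
  three-of-four _ (at₂ e₀) (at₁ e₁) (at₀ e₂) = omit₃ (π210 e₀ e₁ e₂)
  three-of-four _ (at₂ e₀) (at₁ e₁) (at₃ e₂) = omit₀ (π102 e₀ e₁ e₂)
  three-of-four _ (at₂ e₀) (at₃ e₁) (at₀ e₂) = omit₁ (π120 e₀ e₁ e₂)
  three-of-four _ (at₂ e₀) (at₃ e₁) (at₁ e₂) = omit₀ (π120 e₀ e₁ e₂)
  three-of-four _ (at₃ e₀) (at₀ e₁) (at₁ e₂) = omit₂ (π201 e₀ e₁ e₂)
  three-of-four _ (at₃ e₀) (at₀ e₁) (at₂ e₂) = omit₁ (π201 e₀ e₁ e₂)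
  three-of-four _ (at₃ e₀) (at₁ e₁) (at₀ e₂) = omit₂ (π210 e₀ e₁ e₂)
  three-of-four _ (at₃ e₀) (at₁ e₁) (at₂ e₂) = omit₀ (π201 e₀ e₁ e₂)
  three-of-four _ (at₃ e₀) (at₂ e₁) (at₀ e₂) = omit₁ (π210 e₀ e₁ e₂)
  three-of-four _ (at₃ e₀) (at₂ e₁) (at₁ e₂) = omit₀ (π210 e₀ e₁ e₂)
  three-of-four (x₀≉x₁ , _) (at₀ e₀) (at₀ e₁) _ = ⊥-elim (clash x₀≉x₁ e₀ e₁)
  three-of-four (x₀≉x₁ , _) (at₁ e₀) (at₁ e₁) _ = ⊥-elim (clash x₀≉x₁ e₀ e₁)
  three-of-four (x₀≉x₁ , _) (at₂ e₀) (at₂ e₁) _ = ⊥-elim (clash x₀≉x₁ e₀ e₁)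
  three-of-four (x₀≉x₁ , _) (at₃ e₀) (at₃ e₁) _ = ⊥-elim (clash x₀≉x₁ e₀ e₁)
  three-of-four (_ , x₀≉x₂ , _) (at₀ e₀) _ (at₀ e₂) = ⊥-elim (clash x₀≉x₂ e₀ e₂)
  three-of-four (_ , x₀≉x₂ , _) (at₁ e₀) _ (at₁ e₂) = ⊥-elim (clash x₀≉x₂ e₀ e₂)
  three-of-four (_ , x₀≉x₂ , _) (at₂ e₀) _ (at₂ e₂) = ⊥-elim (clash x₀≉x₂ e₀ e₂)
  three-of-four (_ , x₀≉x₂ , _) (at₃ e₀) _ (at₃ e₂) = ⊥-elim (clash x₀≉x₂ e₀ e₂)
  three-of-four (_ , _ , x₁≉x₂) _ (at₀ e₁) (at₀ e₂) = ⊥-elim (clash x₁≉x₂ e₁ e₂)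
  three-of-four (_ , _ , x₁≉x₂) _ (at₁ e₁) (at₁ e₂) = ⊥-elim (clash x₁≉x₂ e₁ e₂)
  three-of-four (_ , _ , x₁≉x₂) _ (at₂ e₁) (at₂ e₂) = ⊥-elim (clash x₁≉x₂ e₁ e₂)
  three-of-four (_ , _ , x₁≉x₂) _ (at₃ e₁) (at₃ e₂) = ⊥-elim (clash x₁≉x₂ e₁ e₂)

  ⊆⇒ThreeOfFour : Distinct x₀ x₁ x₂ →
                  _⊆ₛ_ G (x₀ ∷ x₁ ∷ x₂ ∷ []) (y₀ ∷ y₁ ∷ y₂ ∷ y₃ ∷ []) →
                  ThreeOfFour x₀ x₁ x₂ y₀ y₁ y₂ y₃
  ⊆⇒ThreeOfFour d X⊆Y = three-of-four d (X⊆Y _ (at₀ refl)) (X⊆Y _ (at₁ refl)) (X⊆Y _ (at₂ refl))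

  record TriangleInvariant {p} (P : A → A → A → Set p) : Set (c ⊔ ℓ ⊔ p) where
    field
      cong    : ∀ {x y z x′ y′ z′} → x ≈ x′ → y ≈ y′ → z ≈ z′ → P x y z → P x′ y′ z′
      rotate  : ∀ {x y z} → P x y z → P y z x
      swap    : ∀ {x y z} → P x y z → P y x z
      unapply : ∀ σ {x y z} → P (apply σ x) (apply σ y) (apply σ z) → P x y z

  module _ {p} {P : A → A → A → Set p} (invariant : TriangleInvariant P) where
    open TriangleInvariant invariant

    permute : Permutation₃ x₀ x₁ x₂ y₀ y₁ y₂ → P x₀ x₁ x₂ → P y₀ y₁ y₂
    permute (π012 e₀ e₁ e₂) = cong e₀ e₁ e₂
    permute (π021 e₀ e₁ e₂) = rotate ∘ swap ∘ cong e₀ e₁ e₂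
    permute (π102 e₀ e₁ e₂) = swap ∘ cong e₀ e₁ e₂
    permute (π120 e₀ e₁ e₂) = rotate ∘ rotate ∘ cong e₀ e₁ e₂
    permute (π201 e₀ e₁ e₂) = rotate ∘ cong e₀ e₁ e₂
    permute (π210 e₀ e₁ e₂) = swap ∘ rotate ∘ cong e₀ e₁ e₂

    OrbEq⇒Permutation₃ : Distinct 0# a b → OrbEq G (tri G a b) (tri G x y) →
                         Σ Affine λ σ → Permutation₃ 0# a b (apply σ 0#) (apply σ x) (apply σ y)
    OrbEq⇒Permutation₃ {a} {b} d ab~xy =
      let σ , ab⊆ , _ = orbit⇒image (Equivalence.to (ab~xy (tri G a b)) orbit-refl)
      in σ , ⊆⇒Permutation₃ d ab⊆

    orbit-invariant : Distinct 0# a b → OrbEq G (tri G a b) (tri G x y) → P 0# a b → P 0# x y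
    orbit-invariant d ab~xy P0ab =
      let σ , π = OrbEq⇒Permutation₃ d ab~xy in unapply σ (permute π P0ab)

  Midpoint-apply : ∀ σ → Midpoint x y z → Midpoint (apply σ x) (apply σ y) (apply σ z)
  Midpoint-apply {x} {y} {z} (translate t) m = ≈-by-difference
    (solve 4 (λ x y z t → (x ⊕ t ⊕ (x ⊕ t)) ⊖ (y ⊕ t ⊕ (z ⊕ t)) ⊜ (x ⊕ x) ⊖ (y ⊕ z)) refl x y z t)
    m
  Midpoint-apply {x} {y} {z} (reflect t)   m = ≈-by-difference
    (solve 4 (λ x y z t → (⊝ x ⊕ t ⊕ (⊝ x ⊕ t)) ⊖ (⊝ y ⊕ t ⊕ (⊝ z ⊕ t)) ⊜ (y ⊕ z) ⊖ (x ⊕ x))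
      refl x y z t)
    (sym m)

  NonDegenerate-invariant : TriangleInvariant NonDegenerate
  NonDegenerate-invariant = record
    { cong    = λ x≈ y≈ z≈ nd → let open NonDegenerate nd in nonDegenerate
                  (2x≉2y  ∘ Midpoint-cong x≈ y≈ y≈) (2y≉2z  ∘ Midpoint-cong y≈ z≈ z≈)
                  (2z≉2x  ∘ Midpoint-cong z≈ x≈ x≈) (2x≉y+z ∘ Midpoint-cong x≈ y≈ z≈)
                  (2y≉z+x ∘ Midpoint-cong y≈ z≈ x≈) (2z≉x+y ∘ Midpoint-cong z≈ x≈ y≈)
    ; rotate  = λ nd → let open NonDegenerate nd in
                  nonDegenerate 2y≉2z 2z≉2x 2x≉2y 2y≉z+x 2z≉x+y 2x≉y+z
    ; swap    = λ nd → let open NonDegenerate nd in nonDegenerate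
                  (2x≉2y ∘ sym) (2z≉2x ∘ sym) (2y≉2z ∘ sym)
                  (λ m → 2y≉z+x (trans m (comm _ _))) (λ m → 2x≉y+z (trans m (comm _ _)))
                  (λ m → 2z≉x+y (trans m (comm _ _)))
    ; unapply = λ σ nd → let open NonDegenerate nd in nonDegenerate
                  (2x≉2y  ∘ Midpoint-apply σ) (2y≉2z  ∘ Midpoint-apply σ) (2z≉2x  ∘ Midpoint-apply σ)
                  (2x≉y+z ∘ Midpoint-apply σ) (2y≉z+x ∘ Midpoint-apply σ) (2z≉x+y ∘ Midpoint-apply σ)
    }

  TriCond-resp-OrbEq : TriCond G a b → OrbEq G (tri G a b) (tri G x y) → TriCond G x y
  TriCond-resp-OrbEq tc ab~xy = NonDegenerate⇒TriCond (orbit-invariant NonDegenerate-invariant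
    (TriCond⇒Distinct tc) ab~xy (TriCond⇒NonDegenerate tc))

  infix 4 _≈±_
  _≈±_ : A → A → Set ℓ
  d ≈± e = d ≈ e ⊎ d ≈ - e

  ≈±-trans : d ≈± e → e ≈± e′ → d ≈± e′
  ≈±-trans (inj₁ d≈e)  (inj₁ e≈e′)  = inj₁ (trans d≈e e≈e′)
  ≈±-trans (inj₁ d≈e)  (inj₂ e≈-e′) = inj₂ (trans d≈e e≈-e′)
  ≈±-trans (inj₂ d≈-e) (inj₁ e≈e′)  = inj₂ (trans d≈-e (⁻¹-cong e≈e′))
  ≈±-trans (inj₂ d≈-e) (inj₂ e≈-e′) = inj₁ (trans d≈-e (trans (⁻¹-cong e≈-e′) (⁻¹-involutive _)))

  ≈±-flip : d ≈± y - x → d ≈± x - y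
  ≈±-flip {y = y} {x} d≈± = ≈±-trans d≈± (inj₂ (sym (⁻¹-anti-homo‿- x y)))

  ≈±-resp : e ≈ e′ → d ≈± e → d ≈± e′
  ≈±-resp e≈e′ d≈±e = ≈±-trans d≈±e (inj₁ e≈e′)

  apply-difference : ∀ σ → apply σ y - apply σ x ≈± y - x
  apply-difference {y} {x} (translate t) =
    inj₁ (solve 3 (λ y x t → y ⊕ t ⊖ (x ⊕ t) ⊜ y ⊖ x) refl y x t)
  apply-difference {y} {x} (reflect t)   =
    inj₂ (solve 3 (λ y x t → ⊝ y ⊕ t ⊖ (⊝ x ⊕ t) ⊜ ⊝ (y ⊖ x)) refl y x t)

  Side : A → A → A → A → Set ℓ
  Side d x y z = d ≈± y - x ⊎ d ≈± z - y ⊎ d ≈± x - z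

  Side-invariant : ∀ d → TriangleInvariant (Side d)
  Side-invariant d = record
    { cong    = λ x≈ y≈ z≈ → Sum.map (≈±-resp (-‿cong y≈ x≈))
                               (Sum.map (≈±-resp (-‿cong z≈ y≈)) (≈±-resp (-‿cong x≈ z≈)))
    ; rotate  = Sum.[ inj₂ ∘ inj₂ , Sum.map id inj₁ ]
    ; swap    = Sum.[ inj₁ ∘ ≈±-flip , Sum.[ inj₂ ∘ inj₂ ∘ ≈±-flip , inj₂ ∘ inj₁ ∘ ≈±-flip ] ]
    ; unapply = λ σ → Sum.map (unapplied σ) (Sum.map (unapplied σ) (unapplied σ))
    }
    where
    -‿cong : x ≈ x′ → y ≈ y′ → x - y ≈ x′ - y′
    -‿cong x≈ y≈ = ∙-cong x≈ (⁻¹-cong y≈)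
    unapplied : ∀ σ → d ≈± apply σ y - apply σ x → d ≈± y - x
    unapplied σ d≈± = ≈±-trans d≈± (apply-difference σ)

  -- The side q - p of {0, p, q} is not, up to sign, a side of {0, p, p + q}.
  flip-not-OrbEq : TriCond G p q → ¬ OrbEq G (tri G p q) (tri G p (p + q))
  flip-not-OrbEq {p} {q} tc pq~flip = not-side (orbit-invariant (Side-invariant (q - p))
    (TriCond⇒Distinct tc) pq~flip (inj₂ (inj₁ (inj₁ refl))))
    where
    open NonDegenerate (TriCond⇒NonDegenerate tc)
    not-side : ¬ Side (q - p) 0# p (p + q)
    not-side (inj₁ (inj₁ h)) = 2y≉z+x (≈-by-difference
      (solve 2 (λ p q → p ⊕ p ⊖ (q ⊕ 𝟎) ⊜ (p ⊖ 𝟎) ⊖ (q ⊖ p)) refl p q) (sym h))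
    not-side (inj₁ (inj₂ h)) = 2z≉2x (∙-cong q≈0 q≈0)
      where q≈0 = ≈-by-difference (solve 2 (λ p q → q ⊖ 𝟎 ⊜ (q ⊖ p) ⊖ ⊝ (p ⊖ 𝟎)) refl p q) h
    not-side (inj₂ (inj₁ (inj₁ h))) = 2x≉2y (sym (∙-cong p≈0 p≈0))
      where p≈0 = ≈-by-difference (solve 2 (λ p q → p ⊖ 𝟎 ⊜ (p ⊕ q ⊖ p) ⊖ (q ⊖ p)) refl p q) (sym h)
    not-side (inj₂ (inj₁ (inj₂ h))) = 2z≉x+y (≈-by-difference
      (solve 2 (λ p q → q ⊕ q ⊖ (𝟎 ⊕ p) ⊜ (q ⊖ p) ⊖ ⊝ (p ⊕ q ⊖ p)) refl p q) h)
    not-side (inj₂ (inj₂ (inj₁ h))) = 2z≉2x (≈-by-difference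
      (solve 2 (λ p q → q ⊕ q ⊖ (𝟎 ⊕ 𝟎) ⊜ (q ⊖ p) ⊖ (𝟎 ⊖ (p ⊕ q))) refl p q) h)
    not-side (inj₂ (inj₂ (inj₂ h))) = 2x≉2y (≈-by-difference
      (solve 2 (λ p q → 𝟎 ⊕ 𝟎 ⊖ (p ⊕ p) ⊜ (q ⊖ p) ⊖ ⊝ (𝟎 ⊖ (p ⊕ q))) refl p q) h)

  -- In the parallelogram v, u, w, u + w - v the vertex v is opposite to u + w - v, and the
  -- triangle opposite v u w, unlike {v, u, w}, contains the diagonal through v.
  opposite : A → A → A → List A
  opposite v u w = v ∷ u ∷ u + w - v ∷ []

  opposite-cong : x ≈ x′ → y ≈ y′ → z ≈ z′ → _≐_ G (opposite x y z) (opposite x′ y′ z′)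
  opposite-cong x≈ y≈ z≈ = Permutation₃⇒≐ (π012 x≈ y≈ (∙-cong (∙-cong y≈ z≈) (⁻¹-cong x≈)))

  opposite-swap : OrbEq G (opposite x y z) (opposite x z y)
  opposite-swap {x} {y} {z} = OrbEq-respʳ-≐ (Permutation₃⇒≐ (π210
      (solve 3 (λ x y z → ⊝ x ⊕ (y ⊕ z) ⊜ z ⊕ y ⊖ x) refl x y z)
      (solve 3 (λ x y z → ⊝ y ⊕ (y ⊕ z) ⊜ z) refl x y z)
      (solve 3 (λ x y z → ⊝ (y ⊕ z ⊖ x) ⊕ (y ⊕ z) ⊜ x) refl x y z)))
    (OrbEq-image (reflect (y + z)) _)

  opposite-unapply : ∀ σ → OrbEq G (opposite (apply σ x) (apply σ y) (apply σ z)) (opposite x y z)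
  opposite-unapply {x} {y} {z} σ = OrbEq-trans
    (≐⇒OrbEq (Permutation₃⇒≐ (π012 refl refl (apply-opposite σ)))) (OrbEq-sym (OrbEq-image σ _))
    where
    apply-opposite : ∀ σ → apply σ y + apply σ z - apply σ x ≈ apply σ (y + z - x)
    apply-opposite (translate t) =
      solve 4 (λ x y z t → y ⊕ t ⊕ (z ⊕ t) ⊖ (x ⊕ t) ⊜ y ⊕ z ⊖ x ⊕ t) refl x y z t
    apply-opposite (reflect t)   =
      solve 4 (λ x y z t → ⊝ y ⊕ t ⊕ (⊝ z ⊕ t) ⊖ (⊝ x ⊕ t) ⊜ ⊝ (y ⊕ z ⊖ x) ⊕ t) refl x y z t

  Candidate : List A → A → A → A → Set (c ⊔ ℓ)
  Candidate W x y z =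
    OrbEq G W (opposite x y z) ⊎ OrbEq G W (opposite z x y) ⊎ OrbEq G W (opposite y x z)

  Candidate-invariant : ∀ W → TriangleInvariant (Candidate W)
  Candidate-invariant W = record
    { cong    = λ x≈ y≈ z≈ → Sum.map (OrbEq-respʳ-≐ (opposite-cong x≈ y≈ z≈))
                               (Sum.map (OrbEq-respʳ-≐ (opposite-cong z≈ x≈ y≈))
                                        (OrbEq-respʳ-≐ (opposite-cong y≈ x≈ z≈)))
    ; rotate  = Sum.[ inj₂ ∘ inj₁ , Sum.[ inj₂ ∘ inj₂ ∘ swapped , inj₁ ∘ swapped ] ]
    ; swap    = Sum.[ inj₂ ∘ inj₂ , Sum.[ inj₂ ∘ inj₁ ∘ swapped , inj₁ ] ]
    ; unapply = λ σ → Sum.map (unapplied σ) (Sum.map (unapplied σ) (unapplied σ))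
    }
    where
    swapped : OrbEq G W (opposite x y z) → OrbEq G W (opposite x z y)
    swapped W~ = OrbEq-trans W~ opposite-swap
    unapplied : ∀ σ → OrbEq G W (opposite (apply σ x) (apply σ y) (apply σ z)) →
                OrbEq G W (opposite x y z)
    unapplied σ W~ = OrbEq-trans W~ (opposite-unapply σ)

  Candidate-transfer : TriCond G a b → OrbEq G (tri G a b) (tri G x y) →
                       Candidate W 0# x y → Candidate W 0# a b
  Candidate-transfer tc ab~xy = orbit-invariant (Candidate-invariant _)
    (TriCond⇒Distinct (TriCond-resp-OrbEq tc ab~xy)) (OrbEq-sym ab~xy)

  opposite-origin : _≐_ G (opposite 0# x y) (tri G x (x + y))
  opposite-origin {x} {y} =
    Permutation₃⇒≐ (π012 refl refl (solve 2 (λ x y → x ⊕ y ⊖ 𝟎 ⊜ x ⊕ y) refl x y))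

  opposite-vertex : _≐_ G (opposite x 0# y) (tri G x (y - x))
  opposite-vertex {x} {y} =
    Permutation₃⇒≐ (π102 refl refl (solve 2 (λ x y → 𝟎 ⊕ y ⊖ x ⊜ y ⊖ x) refl x y))

  Candidate-origin : Candidate W 0# a b →
    OrbEq G W (tri G a (a + b)) ⊎ OrbEq G W (tri G b (a - b)) ⊎ OrbEq G W (tri G a (b - a))
  Candidate-origin = Sum.map (OrbEq-respʳ-≐ opposite-origin)
    (Sum.map (OrbEq-respʳ-≐ opposite-vertex) (OrbEq-respʳ-≐ opposite-vertex))

  QuadCond-of-flip : TriCond G p q → TriCond G p (p + q) → QuadCond G p q
  QuadCond-of-flip {p} {q} tc tc′ =
      (λ h → n.2x≉2y (trans (identityʳ 0#) (sym h)))
    , (λ h → n.2z≉2x (trans h (sym (identityʳ 0#))))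
    , proj₁ p∉ ∷ proj₂ p∉ ∷ proj₁ 2p∉ ∷ proj₂ 2p∉ ∷ []
    where
    module n = NonDegenerate (TriCond⇒NonDegenerate tc)
    module m = NonDegenerate (TriCond⇒NonDegenerate tc′)
    ±q,±2q = q ∷ - q ∷ q + q ∷ - (q + q) ∷ []

    neg-shift : - x ≈ y → x ≈ - y
    neg-shift e = trans (sym (⁻¹-involutive _)) (⁻¹-cong e)

    avoids : ∀ {u} → u ≉ q → u ≉ - q → u ≉ q + q → u ≉ - (q + q) →
             _∉₃_ G u ±q,±2q × _∉₃_ G (- u) ±q,±2q
    avoids u≉q u≉-q u≉2q u≉-2q =
      (λ { (at₀ e) → u≉q e ; (at₁ e) → u≉-q e ; (at₂ e) → u≉2q e ; (at₃ e) → u≉-2q e }) ,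
      (λ { (at₀ e) → u≉-q (neg-shift e)  ; (at₁ e) → u≉q (trans (neg-shift e) (⁻¹-involutive _))
         ; (at₂ e) → u≉-2q (neg-shift e) ; (at₃ e) → u≉2q (trans (neg-shift e) (⁻¹-involutive _)) })

    p∉ = avoids
      (λ h → n.2y≉2z (∙-cong h h))
      (λ h → n.2x≉y+z (≈-by-difference
        (solve 2 (λ p q → 𝟎 ⊕ 𝟎 ⊖ (p ⊕ q) ⊜ ⊝ q ⊖ p) refl p q) (sym h)))
      (λ h → n.2z≉x+y (≈-by-difference
        (solve 2 (λ p q → q ⊕ q ⊖ (𝟎 ⊕ p) ⊜ q ⊕ q ⊖ p) refl p q) (sym h)))
      (λ h → m.2z≉x+y (≈-by-difference
        (solve 2 (λ p q → p ⊕ q ⊕ (p ⊕ q) ⊖ (𝟎 ⊕ p) ⊜ p ⊖ ⊝ (q ⊕ q)) refl p q) h))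
    2p∉ = avoids
      (λ h → n.2y≉z+x (trans h (sym (identityʳ q))))
      (λ h → m.2x≉y+z (≈-by-difference
        (solve 2 (λ p q → 𝟎 ⊕ 𝟎 ⊖ (p ⊕ (p ⊕ q)) ⊜ ⊝ q ⊖ (p ⊕ p)) refl p q) (sym h)))
      n.2y≉2z
      (λ h → m.2z≉2x (≈-by-difference
        (solve 2 (λ p q → p ⊕ q ⊕ (p ⊕ q) ⊖ (𝟎 ⊕ 𝟎) ⊜ p ⊕ p ⊖ ⊝ (q ⊕ q)) refl p q) h))

  -- Reflection through the centre of the parallelogram 0, p, q, p + q exchanges the two
  -- triangles of each kind.
  parallelogram-reflection : OrbEq G (tri G p q) (p ∷ q ∷ p + q ∷ []) ×
                             OrbEq G (tri G p (p + q)) (0# ∷ q ∷ p + q ∷ [])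
  parallelogram-reflection {p} {q} =
      OrbEq-respʳ-≐ (Permutation₃⇒≐ (π210 -0+r≈r -p+r≈q
        (solve 2 (λ p q → ⊝ q ⊕ (p ⊕ q) ⊜ p) refl p q))) (OrbEq-image (reflect (p + q)) _)
    , OrbEq-respʳ-≐ (Permutation₃⇒≐ (π210 -0+r≈r -p+r≈q (inverseˡ (p + q))))
        (OrbEq-image (reflect (p + q)) _)
    where
    -0+r≈r = solve 2 (λ p q → ⊝ 𝟎 ⊕ (p ⊕ q) ⊜ p ⊕ q) refl p q
    -p+r≈q = solve 2 (λ p q → ⊝ p ⊕ (p ⊕ q) ⊜ q) refl p q

  triangle-in-parallelogram : TriCond G a b → Incident G (tri G a b) (quad G p q (p + q)) →
                              OrbEq G (tri G a b) (tri G p q) ⊎ OrbEq G (tri G a b) (tri G p (p + q))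
  triangle-in-parallelogram tc (X , Y , ab~X , Q~Y , X⊆Y)
    with orbit⇒image ab~X | orbit⇒image Q~Y
  ... | σ , X≐σab | τ , Y≐τQ
    with ⊆⇒ThreeOfFour (apply-distinct σ (TriCond⇒Distinct tc))
           (λ x → proj₁ Y≐τQ x ∘ X⊆Y x ∘ proj₂ X≐σab x)
  ... | omit₀ π = inj₁ (OrbEq-trans (image-OrbEq σ τ (Permutation₃⇒≐ π))
                                    (OrbEq-sym (proj₁ parallelogram-reflection)))
  ... | omit₁ π = inj₂ (OrbEq-trans (image-OrbEq σ τ (Permutation₃⇒≐ π))
                                    (OrbEq-sym (proj₂ parallelogram-reflection)))
  ... | omit₂ π = inj₂ (image-OrbEq σ τ (Permutation₃⇒≐ π))
  ... | omit₃ π = inj₁ (image-OrbEq σ τ (Permutation₃⇒≐ π))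

  Incident-resp : OrbEq G T T′ → OrbEq G B B′ → Incident G T B → Incident G T′ B′
  Incident-resp T~T′ B~B′ (X , Y , T~X , B~Y , X⊆Y) =
    X , Y , Equivalence.to (T~T′ X) T~X , Equivalence.to (B~B′ Y) B~Y , X⊆Y

  Vertex-resp : OrbEq G W W′ → Vertex G W → Vertex G W′
  Vertex-resp W~W′ (x , y , tc , W~xy) = x , y , tc , OrbEq-trans (OrbEq-sym W~W′) W~xy

  Vertex-TriCond : Vertex G W → OrbEq G W (tri G x y) → TriCond G x y
  Vertex-TriCond (_ , _ , tc , W~) W~xy = TriCond-resp-OrbEq tc (OrbEq-trans (OrbEq-sym W~) W~xy)

  Neighbor-resp : OrbEq G V V′ → OrbEq G W W′ → Neighbor G V W → Neighbor G V′ W′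
  Neighbor-resp V~V′ W~W′ (vW , W≁V , E , edge , V-E , W-E) =
    Vertex-resp W~W′ vW ,
    (λ W′~V′ → W≁V (OrbEq-trans W~W′ (OrbEq-trans W′~V′ (OrbEq-sym V~V′)))) ,
    E , edge , Incident-resp V~V′ OrbEq-refl V-E , Incident-resp W~W′ OrbEq-refl W-E

  Neighbor-sym : Vertex G V → Neighbor G V W → Neighbor G W V
  Neighbor-sym vV (_ , W≁V , E , edge , V-E , W-E) = vV , W≁V ∘ OrbEq-sym , E , edge , W-E , V-E

  flip-Neighbor : TriCond G p q → TriCond G p (p + q) → Neighbor G (tri G p q) (tri G p (p + q))
  flip-Neighbor {p} {q} tc tc′ =
    (p , p + q , tc′ , OrbEq-refl) ,
    flip-not-OrbEq tc ∘ OrbEq-sym ,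
    quad G p q (p + q) , (p , q , QuadCond-of-flip tc tc′ , OrbEq-refl) ,
    (_ , _ , orbit-refl , orbit-refl , ∈⇒⊆ (at₀ refl) (at₁ refl) (at₂ refl)) ,
    (_ , _ , orbit-refl , orbit-refl , ∈⇒⊆ (at₀ refl) (at₁ refl) (at₃ refl))

  Neighbor⇒Candidate : TriCond G a b → Neighbor G (tri G a b) W → Candidate W 0# a b
  Neighbor⇒Candidate tc ((_ , _ , tcW , W~) , W≁ab , E , (p , q , _ , E~Q) , ab-E , W-E)
    with triangle-in-parallelogram tc (Incident-resp OrbEq-refl E~Q ab-E)
       | triangle-in-parallelogram tcW (Incident-resp W~ E~Q W-E)
  ... | inj₁ ab~pq | inj₁ W~pq = ⊥-elim (W≁ab (OrbEq-trans W~ (OrbEq-trans W~pq (OrbEq-sym ab~pq))))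
  ... | inj₂ ab~pr | inj₂ W~pr = ⊥-elim (W≁ab (OrbEq-trans W~ (OrbEq-trans W~pr (OrbEq-sym ab~pr))))
  ... | inj₁ ab~pq | inj₂ W~pr = Candidate-transfer tc ab~pq
    (inj₁ (OrbEq-respʳ-≐ (≐-sym opposite-origin) (OrbEq-trans W~ W~pr)))
  ... | inj₂ ab~pr | inj₁ W~pq = Candidate-transfer tc ab~pr
    (inj₂ (inj₂ (OrbEq-respʳ-≐ (≐-sym (≐-trans opposite-vertex pq≐)) (OrbEq-trans W~ W~pq))))
    where
    pq≐ : _≐_ G (tri G p (p + q - p)) (tri G p q)
    pq≐ = Permutation₃⇒≐ (π012 refl refl (solve 2 (λ p q → p ⊕ q ⊖ p ⊜ q) refl p q))

  Candidate⇒Neighbor : TriCond G a b → Vertex G W →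
    OrbEq G W (tri G a (a + b)) ⊎ OrbEq G W (tri G b (a - b)) ⊎ OrbEq G W (tri G a (b - a)) →
    Neighbor G (tri G a b) W
  Candidate⇒Neighbor tc vW (inj₁ W~) =
    Neighbor-resp OrbEq-refl (OrbEq-sym W~) (flip-Neighbor tc (Vertex-TriCond vW W~))
  Candidate⇒Neighbor {a} {b} tc vW (inj₂ (inj₁ W~)) = Neighbor-resp (OrbEq-sym ab~) (OrbEq-sym W~)
    (Neighbor-sym (_ , _ , tc′ , OrbEq-refl) (flip-Neighbor tc′ (TriCond-resp-OrbEq tc ab~)))
    where
    tc′ = Vertex-TriCond vW W~
    ab~ : OrbEq G (tri G a b) (tri G b (b + (a - b)))
    ab~ = ≐⇒OrbEq (Permutation₃⇒≐ (π021 refl (solve 2 (λ a b → a ⊜ b ⊕ (a ⊖ b)) refl a b) refl))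
  Candidate⇒Neighbor {a} {b} tc vW (inj₂ (inj₂ W~)) = Neighbor-resp (OrbEq-sym ab~) (OrbEq-sym W~)
    (Neighbor-sym (_ , _ , tc′ , OrbEq-refl) (flip-Neighbor tc′ (TriCond-resp-OrbEq tc ab~)))
    where
    tc′ = Vertex-TriCond vW W~
    ab~ : OrbEq G (tri G a b) (tri G a (a + (b - a)))
    ab~ = ≐⇒OrbEq (Permutation₃⇒≐ (π012 refl refl (solve 2 (λ a b → b ⊜ a ⊕ (b ⊖ a)) refl a b)))

lemma3p2 : ∀ {c ℓ} (G : AbelianGroup c ℓ) → Finite G
           → (a b : AbelianGroup.Carrier G)
           → Vertex G (tri G a b)
           → (W : List (AbelianGroup.Carrier G))
           → Neighbor G (tri G a b) W
             ⇔ (Vertex G W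
                × (OrbEq G W (tri G a (AbelianGroup._∙_ G a b))
                   ⊎ OrbEq G W (tri G b (AbelianGroup._∙_ G a (AbelianGroup._⁻¹ G b)))
                   ⊎ OrbEq G W (tri G a (AbelianGroup._∙_ G b (AbelianGroup._⁻¹ G a)))))
lemma3p2 G _ a b (_ , _ , tc , ab~) W = mk⇔
  (λ neighbour → proj₁ neighbour , Candidate-origin G (Neighbor⇒Candidate G tcab neighbour))
  (λ (vW , candidate) → Candidate⇒Neighbor G tcab vW candidate)
  where
  tcab = TriCond-resp-OrbEq G tc (OrbEq-sym G ab~)
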